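{- For any string $B\in\Gamma^*$ of length at least two and any $\ell\ge1$, $|\mathrm{Compress}(B,\ell)|\le\frac23|B|+1$ and $|\mathrm{Compress}(B,\ell)|<|B|$.
   Context: $\Gamma$ is an alphabet containing, for each $a\in\Gamma$ and $r\ge2$ of interest, a repeat symbol $\mathtt r_{a,r}$; $\#\notin\Gamma$; $C_\ell:\Gamma^2\to\Gamma$ is a function. $F_{\mathrm{CVL}}:\Gamma^*\to\{1,2,3\}^*$ is a fixed function such that for each $z\in\Gamma^*$ with no two equal consecutive symbols: $|F_{\mathrm{CVL}}(z)|=|z|$; no two consecutive output symbols are equal; among any three consecutive output symbols at least one is 1; if $|z|=1$ the output is $3$, else it starts with $1$ and ends with $2$ or $3$ (the $i$-th output symbol depends only on $z$ at positions $i-R,\dots,i+R$ for a constant $R$). $\mathrm{Compress}(B,\ell)$: write $B=B_1\cdots B_m$ with $m$ minimal such that every maximal run $a^r$ ($r\ge2$) of equal symbols is one of the $B_i$. Let $B'=B'_1\cdots B'_m$ where a run $B_i=a^r$ gives $B'_i=\mathtt r_{a,r}\#$ with $\mathtt r_{a,r}$ colored 1 and $\#$ colored 2, and any other $B_i$ gives $B'_i=B_i$ colored by $F_{\mathrm{CVL}}(B_i)$. Starting with empty output and $i=1$, while $i<|B'|$: if $B'[i+1]=\#$ append $B'[i]$, else append $C_\ell(B'[i]B'[i+1])$; set $i\leftarrow i+2$; if $i\le|B'|$ and $B'[i]$ is not colored 1, append $B'[i]$ and set $i\leftarrow i+1$. Return the output. -}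

module Defs where

open import Data.Nat using (ℕ; zero; suc; _+_; _≤_)
open import Data.List using (List; []; _∷_; _++_; map; length; head; last; concatMap)
open import Data.Maybe using (Maybe; just; nothing)
open import Data.Product using (_×_; _,_; Σ; ∃)
open import Data.Sum using (_⊎_)
open import Relation.Nullary using (yes; no)
open import Relation.Binary.Definitions using (DecidableEquality)
open import Relation.Binary.PropositionalEquality using (_≡_; _≢_)
open import Data.List.Relation.Unary.Linked using (Linked)

data Color : Set where
  c1 c2 c3 : Color

_!_ : {A : Set} → List A → ℕ → Maybe A
[] ! _ = nothing
(x ∷ xs) ! zero = just x
(x ∷ xs) ! suc n = xs ! n

NoRepeat : {A : Set} → List A → Set
NoRepeat = Linked _≢_

-- The properties assumed of F_CVL (for every nonempty z with no two equal
-- consecutive symbols), including locality with some constant radius R.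
record IsCVL {Γ : Set} (F : List Γ → List Color) : Set where
  field
    len      : ∀ z → NoRepeat z → length (F z) ≡ length z
    proper   : ∀ z → NoRepeat z → NoRepeat (F z)
    three    : ∀ z → NoRepeat z → ∀ i a b c →
               F z ! i ≡ just a → F z ! suc i ≡ just b → F z ! suc (suc i) ≡ just c →
               a ≡ c1 ⊎ b ≡ c1 ⊎ c ≡ c1
    single   : ∀ a → F (a ∷ []) ≡ c3 ∷ []
    startsOne : ∀ z → NoRepeat z → 2 ≤ length z → head (F z) ≡ just c1
    endsTwoThree : ∀ z → NoRepeat z → 2 ≤ length z →
               last (F z) ≡ just c2 ⊎ last (F z) ≡ just c3
    local    : Σ ℕ λ R → ∀ z z' → NoRepeat z → NoRepeat z' → 1 ≤ length z → 1 ≤ length z' →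
               ∀ i → (∀ j → i ≤ j + R → j ≤ i + R → z ! j ≡ z' ! j) →
               F z ! i ≡ F z' ! i

-- Symbols of B': elements of Γ or the separator # (∉ Γ)
data Sym (Γ : Set) : Set where
  sym  : Γ → Sym Γ
  hash : Sym Γ

-- Blocks of the decomposition: a maximal run a^r (r ≥ 2), or a
-- maximal stretch of the remaining symbols (no two equal consecutive).
data Block (Γ : Set) : Set where
  runB  : Γ → ℕ → Block Γ
  plain : List Γ → Block Γ

module Compression {Γ : Set} (_≟_ : DecidableEquality Γ)
                   (rep : Γ → ℕ → Γ)
                   (C : ℕ → Γ → Γ → Γ)
                   (F : List Γ → List Color) where

  -- maximal runs: (a , k) stands for a^(k+1)
  runs : List Γ → List (Γ × ℕ)
  runs [] = []
  runs (a ∷ xs) = ins (runs xs)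
    where
    ins : List (Γ × ℕ) → List (Γ × ℕ)
    ins [] = (a , 0) ∷ []
    ins ((b , k) ∷ rs) with a ≟ b
    ... | yes _ = (b , suc k) ∷ rs
    ... | no _  = (a , 0) ∷ (b , k) ∷ rs

  addPlain : Γ → List (Block Γ) → List (Block Γ)
  addPlain a (plain xs ∷ bs) = plain (a ∷ xs) ∷ bs
  addPlain a bs = plain (a ∷ []) ∷ bs

  -- the decomposition B = B_1 ⋯ B_m with m minimal
  blocks : List (Γ × ℕ) → List (Block Γ)
  blocks [] = []
  blocks ((a , zero) ∷ rs) = addPlain a (blocks rs)
  blocks ((a , suc k) ∷ rs) = runB a (suc (suc k)) ∷ blocks rs

  block′ : Block Γ → List (Sym Γ × Color)
  block′ (runB a r) = (sym (rep a r) , c1) ∷ (hash , c2) ∷ []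
  block′ (plain z) = zipC (map sym z) (F z)
    where
    zipC : List (Sym Γ) → List Color → List (Sym Γ × Color)
    zipC (x ∷ xs) (c ∷ cs) = (x , c) ∷ zipC xs cs
    zipC _ _ = []

  B′ : List Γ → List (Sym Γ × Color)
  B′ B = concatMap block′ (blocks (runs B))

  -- the symbol appended for the pair B'[i] B'[i+1]
  -- (the case with # as first component of C_ℓ never arises)
  out : ℕ → Sym Γ → Sym Γ → Sym Γ
  out ℓ x hash = x
  out ℓ (sym a) (sym b) = sym (C ℓ a b)
  out ℓ hash (sym b) = hash


  loop : ℕ → List (Sym Γ × Color) → List (Sym Γ)
  loop ℓ ((x , _) ∷ (y , _) ∷ []) = out ℓ x y ∷ []
  loop ℓ ((x , _) ∷ (y , _) ∷ (z , c1) ∷ rest) = out ℓ x y ∷ loop ℓ ((z , c1) ∷ rest)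
  loop ℓ ((x , _) ∷ (y , _) ∷ (z , c2) ∷ rest) = out ℓ x y ∷ z ∷ loop ℓ rest
  loop ℓ ((x , _) ∷ (y , _) ∷ (z , c3) ∷ rest) = out ℓ x y ∷ z ∷ loop ℓ rest
  loop ℓ _ = []

  compress : List Γ → ℕ → List (Sym Γ)
  compress B ℓ = loop ℓ (B′ B)

{-# OPTIONS --safe #-}
module Submission where

open import Defs
open import Data.Nat using (ℕ; zero; suc; _+_; _*_; _⊓_; _≤_; _<_; z≤n; s≤s; NonZero; >-nonZero)
open import Data.Nat.Properties
open import Data.List using (List; []; _∷_; length; map; concatMap; zip)
open import Data.Nat.ListAction using (sum)
open import Data.List.Properties using (length-map; length-++; length-zipWith)
open import Data.Product using (_×_; _,_; proj₂)
open import Function using (_∘_)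
open import Relation.Binary.PropositionalEquality using (_≡_; refl; cong)
open import Relation.Binary.Definitions using (DecidableEquality)
open import Relation.Nullary using (yes; no)

-- Every round of the loop reads two symbols of B′ and emits one, or reads
-- three and emits two, so |Compress(B, ℓ)| ≤ ⅔ |B′|.  Moreover |B′| ≤ |B|:
-- a run aʳ with r ≥ 2 becomes the two symbols r_{a,r} #, and a plain block is
-- zipped with its colouring, which never lengthens it.  None of the
-- properties of F_CVL are needed, and the bound holds even without the +1.

*-+-mono-≤ : ∀ a b {k m L n} → a * k ≤ b * m → a * L ≤ b * n → a * (k + L) ≤ b * (m + n)
*-+-mono-≤ a b {k} {m} {L} {n} k≤m L≤n = begin
  a * (k + L)     ≡⟨ *-distribˡ-+ a k L ⟩
  a * k + a * L   ≤⟨ +-mono-≤ k≤m L≤n ⟩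
  b * m + b * n   ≡⟨ *-distribˡ-+ b m n ⟨
  b * (m + n)     ∎
  where open ≤-Reasoning

-- A function given by the clauses of zip is zip; this identifies the helper
-- local to block′, which cannot be referred to by name.
≗-zip : {A B : Set} (f : List A → List B → List (A × B)) →
        (∀ x xs y ys → f (x ∷ xs) (y ∷ ys) ≡ (x , y) ∷ f xs ys) →
        (∀ ys → f [] ys ≡ []) → (∀ x xs → f (x ∷ xs) [] ≡ []) →
        ∀ xs ys → f xs ys ≡ zip xs ys
≗-zip f cons nilˡ nilʳ []       ys       = nilˡ ys
≗-zip f cons nilˡ nilʳ (x ∷ xs) []       = nilʳ x xs
≗-zip f cons nilˡ nilʳ (x ∷ xs) (y ∷ ys) rewrite cons x xs y ys =
  cong ((x , y) ∷_) (≗-zip f cons nilˡ nilʳ xs ys)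

module _ {Γ : Set} (_≟_ : DecidableEquality Γ) (rep : Γ → ℕ → Γ)
         (C : ℕ → Γ → Γ → Γ) (F : List Γ → List Color) where

  open Compression _≟_ rep C F

  length-loop : ∀ ℓ xs → 3 * length (loop ℓ xs) ≤ 2 * length xs
  length-loop ℓ []                              = z≤n
  length-loop ℓ (_ ∷ [])                        = z≤n
  length-loop ℓ (_ ∷ _ ∷ [])                    = s≤s (s≤s (s≤s z≤n))
  length-loop ℓ (_ ∷ _ ∷ (z , c1) ∷ rest) =
    *-+-mono-≤ 3 2 {1} {2} {n = length ((z , c1) ∷ rest)} (s≤s (s≤s (s≤s z≤n)))
      (length-loop ℓ ((z , c1) ∷ rest))
  length-loop ℓ (_ ∷ _ ∷ (z , c2) ∷ rest) =
    *-+-mono-≤ 3 2 {2} {3} {n = length rest} ≤-refl (length-loop ℓ rest)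
  length-loop ℓ (_ ∷ _ ∷ (z , c3) ∷ rest) =
    *-+-mono-≤ 3 2 {2} {3} {n = length rest} ≤-refl (length-loop ℓ rest)

  block′-plain≡zip : ∀ z → block′ (plain z) ≡ zip (map sym z) (F z)
  block′-plain≡zip z with ≗-zip _ (λ _ _ _ _ → refl) (λ _ → refl) (λ _ _ → refl) | map sym z | F z
  ... | zipC≗zip | xs | cs = zipC≗zip xs cs

  length-block′-plain : ∀ z → length (block′ (plain z)) ≤ length z
  length-block′-plain z = begin
    length (block′ (plain z))               ≡⟨ cong length (block′-plain≡zip z) ⟩
    length (zip (map sym z) (F z))          ≡⟨ length-zipWith _,_ (map sym z) (F z) ⟩
    length (map sym z) ⊓ length (F z)       ≤⟨ m⊓n≤m _ _ ⟩
    length (map sym z)                      ≡⟨ length-map sym z ⟩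
    length z                                ∎
    where open ≤-Reasoning

  -- An upper bound on |block′ b| that does not mention F, unlike block′ itself.
  width : Block Γ → ℕ
  width (runB _ _) = 2
  width (plain z)  = length z

  length-block′ : ∀ b → length (block′ b) ≤ width b
  length-block′ (runB a r) = ≤-refl
  length-block′ (plain z)  = length-block′-plain z

  length-concatMap-block′ : ∀ bs → length (concatMap block′ bs) ≤ sum (map width bs)
  length-concatMap-block′ []       = z≤n
  length-concatMap-block′ (b ∷ bs) rewrite length-++ (block′ b) {concatMap block′ bs} =
    +-mono-≤ (length-block′ b) (length-concatMap-block′ bs)

  width-addPlain : ∀ a bs → sum (map width (addPlain a bs)) ≡ suc (sum (map width bs))
  width-addPlain a []              = refl
  width-addPlain a (runB _ _ ∷ bs) = refl
  width-addPlain a (plain _ ∷ bs)  = refl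

  runsLength : List (Γ × ℕ) → ℕ
  runsLength rs = sum (map (suc ∘ proj₂) rs)

  width-blocks≤ : ∀ rs → sum (map width (blocks rs)) ≤ runsLength rs
  width-blocks≤ []                  = z≤n
  width-blocks≤ ((a , zero) ∷ rs) rewrite width-addPlain a (blocks rs) = s≤s (width-blocks≤ rs)
  width-blocks≤ ((a , suc k) ∷ rs)  = s≤s (s≤s (≤-trans (width-blocks≤ rs) (m≤n+m _ k)))

  runsLength-runs : ∀ B → runsLength (runs B) ≡ length B
  runsLength-runs []       = refl
  runsLength-runs (a ∷ xs) with runs xs | runsLength-runs xs
  ... | []           | eq = cong suc eq
  ... | (b , _) ∷ _  | eq with a ≟ b
  ...   | yes _ = cong suc eq
  ...   | no _  = cong suc eq

  length-B′ : ∀ B → length (B′ B) ≤ length B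
  length-B′ B = begin
    length (B′ B)                       ≤⟨ length-concatMap-block′ (blocks (runs B)) ⟩
    sum (map width (blocks (runs B)))   ≤⟨ width-blocks≤ (runs B) ⟩
    runsLength (runs B)                 ≡⟨ runsLength-runs B ⟩
    length B                            ∎
    where open ≤-Reasoning

  length-compress : ∀ B ℓ → 3 * length (compress B ℓ) ≤ 2 * length B
  length-compress B ℓ = ≤-trans (length-loop ℓ (B′ B)) (*-monoʳ-≤ 2 (length-B′ B))

lemma1 : {Γ : Set} (_≟_ : DecidableEquality Γ) (rep : Γ → ℕ → Γ) (C : ℕ → Γ → Γ → Γ)
         (F : List Γ → List Color) → IsCVL F →
         (B : List Γ) (ℓ : ℕ) → 2 ≤ length B → 1 ≤ ℓ →
         (3 * length (Compression.compress _≟_ rep C F B ℓ) ≤ 2 * length B + 3)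
         × (length (Compression.compress _≟_ rep C F B ℓ) < length B)
lemma1 _≟_ rep C F _ B ℓ 2≤|B| _ =
  ≤-trans bound (m≤m+n _ 3) ,
  *-cancelˡ-< 3 _ _ (≤-<-trans bound (*-monoˡ-< (length B) {{nonZero-|B|}} (n<1+n 2)))
  where
  bound : 3 * length (Compression.compress _≟_ rep C F B ℓ) ≤ 2 * length B
  bound = length-compress _≟_ rep C F B ℓ

  nonZero-|B| : NonZero (length B)
  nonZero-|B| = >-nonZero (≤-trans (s≤s z≤n) 2≤|B|)
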